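{- For every countable ordinal $\alpha$ with $1<\alpha<\omega_1$, $(\mathrm{fin}^{\otimes\alpha},\subseteq)\equiv_T(\omega^\omega,\le)$, where $\le$ on $\omega^\omega$ is everywhere domination.
   Context: $\mathrm{fin}=[\omega]^{<\omega}$. Sets $\omega^\alpha$ and ideals $\mathrm{fin}^{\otimes\alpha}$ on them are defined recursively: $\omega^1=\omega$, $\mathrm{fin}^{\otimes1}=\mathrm{fin}$; $\omega^{\alpha+1}=\omega\times\omega^\alpha$ and $A\in\mathrm{fin}^{\otimes\alpha+1}$ iff for all but finitely many $n$, $(A)_n=\{y:(n,y)\in A\}\in\mathrm{fin}^{\otimes\alpha}$; for limit $\alpha$, a fixed increasing sequence $\langle\alpha_n\rangle$ of nonzero ordinals with supremum $\alpha$ is used, $\omega^\alpha=\biguplus_n\{n\}\times\omega^{\alpha_n}$, and $A\in\mathrm{fin}^{\otimes\alpha}$ iff for all but finitely many $n$, $(A)_n\in\mathrm{fin}^{\otimes\alpha_n}$. $\omega^\omega$ (the set of functions $\omega\to\omega$) has $f\le g$ iff $f(n)\le g(n)$ for all $n$. $P\le_TQ$ means there is $f:Q\to P$ mapping cofinal subsets to cofinal subsets; $\equiv_T$ is two-way $\le_T$. -}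

module Defs where

open import Level using (Level; _⊔_) renaming (suc to lsuc; zero to lzero)
open import Data.Nat using (ℕ; zero; suc; _<_) renaming (_≤_ to _≤ℕ_)
open import Data.Product using (Σ; ∃; ∃-syntax; _×_; _,_)
open import Relation.Unary using (Pred; _⊆_)

-- Countable ordinals ≥ 1 as Brouwer trees.  A limit node carries the
-- fixed fundamental sequence ⟨αₙ⟩ used in the definition of fin^⊗α.

data Ord : Set where
  one  : Ord
  succ : Ord → Ord
  lim  : (ℕ → Ord) → Ord

data _≤ₒ_ : Ord → Ord → Set where
  one≤     : ∀ {a} → one ≤ₒ a
  succ-mono : ∀ {a b} → a ≤ₒ b → succ a ≤ₒ succ b
  ≤-trans  : ∀ {a b c} → a ≤ₒ b → b ≤ₒ c → a ≤ₒ c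
  ≤-succ   : ∀ {a} → a ≤ₒ succ a
  ≤-cocone : ∀ {a f} k → a ≤ₒ f k → a ≤ₒ lim f
  ≤-limiting : ∀ {a f} → (∀ k → f k ≤ₒ a) → lim f ≤ₒ a

_<ₒ_ : Ord → Ord → Set
a <ₒ b = succ a ≤ₒ b

data WF : Ord → Set where
  wf-one  : WF one
  wf-succ : ∀ {a} → WF a → WF (succ a)
  wf-lim  : ∀ {f} → (∀ n → WF (f n)) → (∀ n → f n <ₒ f (suc n)) → WF (lim f)

Pt : Ord → Set
Pt one      = ℕ
Pt (succ a) = ℕ × Pt a
Pt (lim f)  = Σ ℕ (λ n → Pt (f n))

-- Membership in fin^⊗α ; subsets of ω^α are predicates.
-- fin: bounded (= finite) subsets of ℕ.
InFin : (α : Ord) → Pred (Pt α) lzero → Set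
InFin one      A = ∃[ N ] (∀ n → A n → n < N)
InFin (succ a) A = ∃[ N ] (∀ n → N ≤ℕ n → InFin a (λ y → A (n , y)))
InFin (lim f)  A = ∃[ N ] (∀ n → N ≤ℕ n → InFin (f n) (λ y → A (n , y)))

FinIdeal : Ord → Set₁
FinIdeal α = Σ (Pred (Pt α) lzero) (InFin α)

_⊆fin_ : ∀ {α} → FinIdeal α → FinIdeal α → Set
(A , _) ⊆fin (B , _) = A ⊆ B

Baire : Set
Baire = ℕ → ℕ

_≤*_ : Baire → Baire → Set
f ≤* g = ∀ n → f n ≤ℕ g n

Cofinal : ∀ {a ℓ r} (P : Set a) (_≤_ : P → P → Set ℓ) → Pred P r → Set (a ⊔ ℓ ⊔ r)
Cofinal P _≤_ X = ∀ p → ∃[ x ] (X x × p ≤ x)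

Image : ∀ {a b r} {P : Set a} {Q : Set b} → (Q → P) → Pred Q r → Pred P _
Image {Q = Q} f X p = ∃[ q ] (X q × f q ≡ p)
  where open import Relation.Binary.PropositionalEquality using (_≡_)

TukeyLE : ∀ {a ℓ b m} (P : Set a) (_≤P_ : P → P → Set ℓ) (Q : Set b) (_≤Q_ : Q → Q → Set m)
        → Set (a ⊔ ℓ ⊔ lsuc b ⊔ m)
TukeyLE {b = b} P _≤P_ Q _≤Q_ =
  Σ (Q → P) λ f → (X : Pred Q b) → Cofinal Q _≤Q_ X → Cofinal P _≤P_ (Image f X)

TukeyEq : ∀ {a ℓ b m} (P : Set a) (_≤P_ : P → P → Set ℓ) (Q : Set b) (_≤Q_ : Q → Q → Set m)
        → Set _
TukeyEq P _≤P_ Q _≤Q_ = TukeyLE P _≤P_ Q _≤Q_ × TukeyLE Q _≤Q_ P _≤P_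

{-# OPTIONS --safe #-}
-- Each column of ω^α is again some ω^β, so ω^α is a disjoint union of columns.
--
-- fin^⊗α ≤_T ω^ω: a function g codes a set box_g ∈ fin^⊗α — all columns
-- below g 0, together with, in each column n, the box coded by the tail of g
-- after n. The map g ↦ box_g is monotone, and every A ∈ fin^⊗α lies in some
-- box_g, because countably many column codes are dominated by the tails of a
-- single diagonal bound.
--
-- ω^ω ≤_T fin^⊗α for α > 1: ω^α then has columns, and in each of them the
-- "slab" of points whose last coordinate is below k is small. A set
-- A ∈ fin^⊗α containing the slabs of widths max_{j ≤ n} g j in the columns n
-- bounds those widths, column by column, and so yields a function dominating g.
module Submission where

open import Defs
open import Level using () renaming (zero to lzero)
open import Function using (_∘_)
open import Data.Nat using (ℕ; zero; suc; _<_; _+_; _∸_; _⊔_; z≤n; s≤s; _≤?_; _<?_) renaming (_≤_ to _≤ℕ_)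
open import Data.Nat.Properties using (≤-refl; <-≤-trans; <⇒≱; ≮⇒≥; m≤m+n; m≤m⊔n; m≤n⊔m; m≤n⇒m<n∨m≡n; m+n∸m≡n) renaming (≤-trans to ≤ℕ-trans)
open import Data.Product using (Σ; ∃-syntax; _,_; proj₁; proj₂)
open import Data.Sum using (_⊎_; inj₁; inj₂)
open import Data.Empty using (⊥; ⊥-elim)
open import Data.Unit using (⊤; tt)
open import Relation.Nullary using (¬_; yes; no; contradiction)
open import Relation.Unary using (Pred; _⊆_)
open import Relation.Binary.PropositionalEquality using (refl; subst)

convergent⇒TukeyLE : ∀ {a ℓ b m} {P : Set a} {_≤P_ : P → P → Set ℓ} {Q : Set b} {_≤Q_ : Q → Q → Set m}
  (f : Q → P) → (∀ p → Σ Q λ q → ∀ q′ → q ≤Q q′ → p ≤P f q′) → TukeyLE P _≤P_ Q _≤Q_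
convergent⇒TukeyLE f convergent = f , λ X X-cofinal p →
  let (q , above) = convergent p
      (x , x∈X , q≤x) = X-cofinal q
  in f x , (x , x∈X , refl) , above x q≤x

IsOne : Ord → Set
IsOne one      = ⊤
IsOne (succ a) = ⊥
IsOne (lim f)  = ∀ k → IsOne (f k)

IsOne-antimono : ∀ {a b} → a ≤ₒ b → IsOne b → IsOne a
IsOne-antimono one≤            _ = tt
IsOne-antimono (succ-mono _)   ()
IsOne-antimono (≤-trans p q)   b = IsOne-antimono p (IsOne-antimono q b)
IsOne-antimono ≤-succ          ()
IsOne-antimono (≤-cocone k p)  b = IsOne-antimono p (b k)
IsOne-antimono (≤-limiting ps) b = λ k → IsOne-antimono (ps k) b

one≮one : ¬ one <ₒ one
one≮one 1<1 = IsOne-antimono 1<1 tt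

InFin-antimono : ∀ α {A B : Pred (Pt α) lzero} → A ⊆ B → InFin α B → InFin α A
InFin-antimono one      A⊆B (N , bound) = N , λ n n∈A → bound n (A⊆B n∈A)
InFin-antimono (succ a) A⊆B (N , small) = N , λ n N≤n → InFin-antimono a A⊆B (small n N≤n)
InFin-antimono (lim f)  A⊆B (N , small) = N , λ n N≤n → InFin-antimono (f n) A⊆B (small n N≤n)

runningMax : Baire → Baire
runningMax g zero    = g zero
runningMax g (suc n) = runningMax g n ⊔ g (suc n)

≤-runningMax : ∀ g {j n} → j ≤ℕ n → g j ≤ℕ runningMax g n
≤-runningMax g {zero}  {zero}  _   = ≤-refl
≤-runningMax g {j}     {suc n} j≤n with m≤n⇒m<n∨m≡n j≤n
... | inj₁ (s≤s j≤n′) = ≤ℕ-trans (≤-runningMax g j≤n′) (m≤m⊔n _ _)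
... | inj₂ refl                 = m≤n⊔m _ _

diagonalBound : (ℕ → Baire) → Baire
diagonalBound hs k = runningMax (λ j → hs j (k ∸ j)) k

≤-diagonalBound : ∀ hs n m → hs n m ≤ℕ diagonalBound hs (n + m)
≤-diagonalBound hs n m =
  subst (λ i → hs n i ≤ℕ diagonalBound hs (n + m)) (m+n∸m≡n n m)
        (≤-runningMax (λ j → hs j (n + m ∸ j)) (m≤m+n n m))

-- ω^(succ a) and ω^(lim f) are, definitionally, the layers with columns c = λ _ → a and c = f.
Layer : (ℕ → Ord) → Set
Layer c = Σ ℕ (Pt ∘ c)

InFinLayer : (c : ℕ → Ord) → Pred (Layer c) lzero → Set
InFinLayer c A = ∃[ N ] (∀ n → N ≤ℕ n → InFin (c n) (λ y → A (n , y)))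

_⊆ˢ_ : ∀ {X : Set} {Small : Pred X lzero → Set} → Σ (Pred X lzero) Small → Σ (Pred X lzero) Small → Set
(A , _) ⊆ˢ (B , _) = A ⊆ B

record Boxes {X : Set} (Small : Pred X lzero → Set) : Set₁ where
  field
    box         : Baire → Pred X lzero
    box-small   : ∀ g → Small (box g)
    box-mono    : ∀ {g h} → g ≤* h → box g ⊆ box h
    box-cofinal : ∀ {A} → Small A → ∃[ g ] A ⊆ box g

Boxes⇒TukeyLE : ∀ {X} {Small : Pred X lzero → Set} →
  Boxes Small → TukeyLE (Σ (Pred X lzero) Small) _⊆ˢ_ Baire _≤*_
Boxes⇒TukeyLE boxes = convergent⇒TukeyLE (λ g → box g , box-small g) λ (A , A-small) →
  let (g , A⊆box) = box-cofinal A-small in g , λ h g≤h {x} x∈A → box-mono g≤h (A⊆box x∈A)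
  where open Boxes boxes

intervalBoxes : Boxes (InFin one)
intervalBoxes = record
  { box         = λ g m → m < g 0
  ; box-small   = λ g → g 0 , λ _ m<g0 → m<g0
  ; box-mono    = λ g≤h m<g0 → <-≤-trans m<g0 (g≤h 0)
  ; box-cofinal = λ (N , bound) → (λ _ → N) , λ {m} → bound m
  }

shift : Baire → ℕ → Baire
shift g n m = g (suc (n + m))

layerBoxes : (c : ℕ → Ord) → ((n : ℕ) → Boxes (InFin (c n))) → Boxes (InFinLayer c)
layerBoxes c columns = record
  { box = box ; box-small = box-small ; box-mono = box-mono ; box-cofinal = box-cofinal }
  where
  module C n = Boxes (columns n)

  box : Baire → Pred (Layer c) lzero
  box g (n , y) = n < g 0 ⊎ C.box n (shift g n) y

  box-small : ∀ g → InFinLayer c (box g)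
  box-small g = g 0 , λ n g0≤n → InFin-antimono (c n)
    (λ { (inj₁ n<g0) → contradiction g0≤n (<⇒≱ n<g0) ; (inj₂ y∈box) → y∈box })
    (C.box-small n (shift g n))

  box-mono : ∀ {g h} → g ≤* h → box g ⊆ box h
  box-mono g≤h (inj₁ n<g0)           = inj₁ (<-≤-trans n<g0 (g≤h 0))
  box-mono g≤h {n , _} (inj₂ y∈box) = inj₂ (C.box-mono n (λ m → g≤h (suc (n + m))) y∈box)

  box-cofinal : ∀ {A} → InFinLayer c A → ∃[ g ] A ⊆ box g
  box-cofinal {A} (N , small) = g , A⊆box
    where
    columnCode : ∀ n → Σ Baire λ h → N ≤ℕ n → (λ y → A (n , y)) ⊆ C.box n h
    columnCode n with N ≤? n
    ... | yes N≤n = let (h , A⊆) = C.box-cofinal n (small n N≤n) in h , λ _ → A⊆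
    ... | no  N≰n = (λ _ → 0) , λ N≤n → contradiction N≤n N≰n

    g : Baire
    g zero    = N
    g (suc k) = diagonalBound (proj₁ ∘ columnCode) k

    A⊆box : A ⊆ box g
    A⊆box {n , y} a with n <? N
    ... | yes n<N = inj₁ n<N
    ... | no  n≮N = inj₂ (C.box-mono n (≤-diagonalBound (proj₁ ∘ columnCode) n)
                                         (proj₂ (columnCode n) (≮⇒≥ n≮N) a))

boxes : ∀ α → Boxes (InFin α)
boxes one      = intervalBoxes
boxes (succ a) = layerBoxes (λ _ → a) (λ _ → boxes a)
boxes (lim f)  = layerBoxes f (λ n → boxes (f n))

lastCoord : ∀ α → Pt α → ℕ
lastCoord one      m       = m
lastCoord (succ a) (_ , y) = lastCoord a y
lastCoord (lim f)  (n , y) = lastCoord (f n) y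

Slab : ∀ α → ℕ → Pred (Pt α) lzero
Slab α k y = lastCoord α y < k

Slab-small : ∀ α k → InFin α (Slab α k)
Slab-small one      k = k , λ _ m<k → m<k
Slab-small (succ a) k = 0 , λ _ _ → Slab-small a k
Slab-small (lim f)  k = 0 , λ n _ → Slab-small (f n) k

slabBound : ∀ α {B} → InFin α B → ℕ
slabBound one      (N , _)     = N
slabBound (succ a) (N , small) = slabBound a (small N ≤-refl)
slabBound (lim f)  (N , small) = slabBound (f N) (small N ≤-refl)

Slab⊆⇒≤slabBound : ∀ α k {B} (B-small : InFin α B) → Slab α k ⊆ B → k ≤ℕ slabBound α B-small
Slab⊆⇒≤slabBound one      zero    _           _      = z≤n
Slab⊆⇒≤slabBound one      (suc k) (N , bound) Slab⊆B = bound k (Slab⊆B ≤-refl)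
Slab⊆⇒≤slabBound (succ a) k       (N , small) Slab⊆B = Slab⊆⇒≤slabBound a k (small N ≤-refl) Slab⊆B
Slab⊆⇒≤slabBound (lim f)  k       (N , small) Slab⊆B = Slab⊆⇒≤slabBound (f N) k (small N ≤-refl) Slab⊆B

Baire≤layer : (c : ℕ → Ord) → TukeyLE Baire _≤*_ (Σ (Pred (Layer c) lzero) (InFinLayer c)) _⊆ˢ_
Baire≤layer c = convergent⇒TukeyLE bound λ g → slabs g , λ (B , N , small) slabs⊆B k →
  ≤ℕ-trans (≤-runningMax g (m≤m⊔n k N))
           (Slab⊆⇒≤slabBound (c (k ⊔ N)) _ (small (k ⊔ N) (m≤n⊔m k N)) (λ {y} → slabs⊆B {k ⊔ N , y}))
  where
  bound : Σ (Pred (Layer c) lzero) (InFinLayer c) → Baire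
  bound (B , N , small) k = slabBound (c (k ⊔ N)) (small (k ⊔ N) (m≤n⊔m k N))

  slabs : Baire → Σ (Pred (Layer c) lzero) (InFinLayer c)
  slabs g = (λ (n , y) → Slab (c n) (runningMax g n) y) , 0 , λ n _ → Slab-small (c n) (runningMax g n)

Baire≤FinIdeal : ∀ α → one <ₒ α → TukeyLE Baire _≤*_ (FinIdeal α) (_⊆fin_ {α})
Baire≤FinIdeal one      1<1 = ⊥-elim (one≮one 1<1)
Baire≤FinIdeal (succ a) _   = Baire≤layer (λ _ → a)
Baire≤FinIdeal (lim f)  _   = Baire≤layer f

-- Neither Tukey map needs the fundamental sequences to be increasing.
theorem3p3 : (α : Ord) → WF α → one <ₒ α →
    TukeyEq (FinIdeal α) (_⊆fin_ {α}) Baire _≤*_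
theorem3p3 α _ 1<α = Boxes⇒TukeyLE (boxes α) , Baire≤FinIdeal α 1<α
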